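{- For every integer $n\ge 1$ and every integer $m\ge 0$, the number of partitions $\lambda$ into distinct parts with largest part $\lambda_1=m$ and $n=\lambda_1+(\lambda_2+\lambda_4+\lambda_6+\cdots)$ equals the number of partitions of $n+1$ into parts all greater than $1$ whose largest hook length equals $m+1$.
   Context: Partitions are written $\lambda_1\ge\lambda_2\ge\cdots$ with $\lambda_i=0$ beyond the number of parts $\ell(\lambda)$; a partition into distinct parts has strictly decreasing nonzero parts. The largest hook length of a nonempty partition $\mu$ is the hook length of the cell $(1,1)$ of its Young diagram, namely $\mu_1+\ell(\mu)-1$. -}

module Defs where

open import Data.Nat using (ℕ; zero; suc; _+_; _<_; _≥_; _>_)
open import Data.List using (List; []; _∷_; length)
open import Data.Nat.ListAction using (sum)
open import Data.List.Relation.Unary.All using (All)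
open import Data.List.Relation.Unary.Linked using (Linked)
open import Data.Product using (_×_; Σ)
open import Relation.Binary.PropositionalEquality using (_≡_)

-- A partition is a finite list of its nonzero parts λ₁ ≥ λ₂ ≥ ⋯ ≥ λ_ℓ > 0
-- (parts beyond the length are implicitly 0).
IsPartition : List ℕ → Set
IsPartition l = Linked _≥_ l × All (0 <_) l

IsDistinctPartition : List ℕ → Set
IsDistinctPartition l = Linked _>_ l × All (0 <_) l

IsPartitionOf : ℕ → List ℕ → Set
IsPartitionOf n l = IsPartition l × sum l ≡ n

largestPart : List ℕ → ℕ
largestPart []      = 0
largestPart (x ∷ _) = x

-- λ₂ + λ₄ + λ₆ + ⋯
evenIndexedSum : List ℕ → ℕ
evenIndexedSum []           = 0
evenIndexedSum (_ ∷ [])     = 0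
evenIndexedSum (_ ∷ y ∷ ys) = y + evenIndexedSum ys

-- largest hook length μ₁ + ℓ(μ) - 1 of a nonempty partition
-- (the value 0 on the empty list is never used below)
largestHook : List ℕ → ℕ
largestHook []       = 0
largestHook (x ∷ xs) = x + length xs

DistinctSide : ℕ → ℕ → Set
DistinctSide n m =
  Σ (List ℕ) λ l → IsDistinctPartition l × largestPart l ≡ m × n ≡ largestPart l + evenIndexedSum l

HookSide : ℕ → ℕ → Set
HookSide n m =
  Σ (List ℕ) λ l → IsPartitionOf (suc n) l × All (1 <_) l × largestHook l ≡ suc m

-- Deleting the first row and column of a partition ν leaves a partition ν⁻, and ν is recovered
-- from ν⁻, its largest hook a and b = ν₁ + ℓ(ν⁻) − 1; here b < a and the largest hook of ν⁻ is
-- less than b. Iterating, ν ↦ (a₁, b₁, a₂, b₂, …) is a bijection from partitions onto partitions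
-- into distinct parts, under which |ν| = a₁ + a₂ + ⋯ and the largest hook of ν is a₁. The number
-- of parts of ν equal to 1 is a₁ − b₁ − 1, so the partitions of n + 1 with all parts > 1 and
-- largest hook m + 1 correspond exactly to the distinct partitions (m + 1, λ₁, λ₂, …) with λ₁ = m
-- and (m + 1) + λ₂ + λ₄ + ⋯ = n + 1.

module Submission where

open import Defs
open import Data.Nat using (ℕ; zero; suc; pred; _+_; _∸_; _≤_; _<_; _≥_; z≤n; s≤s)
open import Data.Nat.Properties
open import Data.Nat.Tactic.RingSolver using (solve-∀)
open import Data.List using (List; []; _∷_; length; replicate; drop)
open import Data.List.Properties using (length-replicate)
open import Data.Nat.ListAction using (sum)
open import Data.List.Relation.Unary.All as All using (All; []; _∷_)
open import Data.List.Relation.Unary.Linked as Linked using (Linked; []; [-]; _∷_)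
open import Data.Product using (_×_; _,_; Σ; ∃; proj₁; proj₂)
open import Relation.Binary.PropositionalEquality
open import Relation.Nullary using (Irrelevant)
open import Function.Bundles using (_↔_; mk↔ₛ′)

addColumn : ℕ → List ℕ → List ℕ
addColumn r []      = replicate r 1
addColumn r (x ∷ v) = suc x ∷ addColumn r v

-- The partition with largest hook a, first row of length b + 1 − ℓ(v), and v left over once its
-- first row and column are deleted.
wrapHook : ℕ → ℕ → List ℕ → List ℕ
wrapHook a b v = (suc b ∸ length v) ∷ addColumn (a ∸ suc b) v

-- One more than the largest hook (resp. largest part), except that both are 0 on [].
hook⁺ : List ℕ → ℕ
hook⁺ ν = largestPart ν + length ν

part⁺ : List ℕ → ℕ
part⁺ []      = 0
part⁺ (a ∷ _) = suc a

replicate-one-linked : ∀ r → Linked _≥_ (replicate r 1)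
replicate-one-linked zero          = []
replicate-one-linked (suc zero)    = [-]
replicate-one-linked (suc (suc r)) = ≤-refl ∷ replicate-one-linked (suc r)

sum-replicate-one : ∀ r → sum (replicate r 1) ≡ r
sum-replicate-one zero    = refl
sum-replicate-one (suc r) = cong suc (sum-replicate-one r)

addColumn-linked : ∀ r {v} → Linked _≥_ v → Linked _≥_ (addColumn r v)
addColumn-linked r             []            = replicate-one-linked r
addColumn-linked zero          [-]           = [-]
addColumn-linked (suc r)       [-]           = s≤s z≤n ∷ replicate-one-linked (suc r)
addColumn-linked r {x ∷ y ∷ v} (x≥y ∷ y∷v↘) = s≤s x≥y ∷ addColumn-linked r y∷v↘

addColumn-positive : ∀ r v → All (0 <_) (addColumn r v)
addColumn-positive zero    []      = []
addColumn-positive (suc r) []      = s≤s z≤n ∷ addColumn-positive r []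
addColumn-positive r       (x ∷ v) = s≤s z≤n ∷ addColumn-positive r v

addColumn-zero->1 : ∀ {v} → All (0 <_) v → All (1 <_) (addColumn 0 v)
addColumn-zero->1 []         = []
addColumn-zero->1 (px ∷ pxs) = s≤s px ∷ addColumn-zero->1 pxs

largestPart-addColumn : ∀ r v → largestPart (addColumn r v) ≤ suc (largestPart v)
largestPart-addColumn zero    []      = z≤n
largestPart-addColumn (suc r) []      = ≤-refl
largestPart-addColumn r       (x ∷ v) = ≤-refl

length-addColumn : ∀ r v → length (addColumn r v) ≡ length v + r
length-addColumn r []      = length-replicate r
length-addColumn r (x ∷ v) = cong suc (length-addColumn r v)

sum-addColumn : ∀ r v → sum (addColumn r v) ≡ length v + sum v + r
sum-addColumn r []      = sum-replicate-one r
sum-addColumn r (x ∷ v) = begin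
  suc x + sum (addColumn r v)   ≡⟨ cong (suc x +_) (sum-addColumn r v) ⟩
  suc x + (length v + sum v + r) ≡⟨ shuffle x (length v) (sum v) r ⟩
  suc (length v) + (x + sum v) + r ∎
  where
  open ≡-Reasoning
  shuffle : ∀ x l s r → suc x + (l + s + r) ≡ suc l + (x + s) + r
  shuffle = solve-∀

linked-∷ : ∀ {x xs} → largestPart xs ≤ x → Linked _≥_ xs → Linked _≥_ (x ∷ xs)
linked-∷ {xs = []}    _   _   = [-]
linked-∷ {xs = _ ∷ _} x≥y xs↘ = x≥y ∷ xs↘

wrapHook-isPartition : ∀ a {b v} → IsPartition v → hook⁺ v ≤ b → IsPartition (wrapHook a b v)
wrapHook-isPartition a {b} {v} (v↘ , v>0) fits =
  linked-∷ first≥ (addColumn-linked (a ∸ suc b) v↘) ,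
  m<n⇒0<n∸m (s≤s (≤-trans (m≤n+m (length v) (largestPart v)) fits)) ∷
  addColumn-positive (a ∸ suc b) v
  where
  first≥ : largestPart (addColumn (a ∸ suc b) v) ≤ suc b ∸ length v
  first≥ = ≤-trans (largestPart-addColumn (a ∸ suc b) v)
                   (m+n≤o⇒m≤o∸n (suc (largestPart v)) (s≤s fits))

fits⇒length≤ : ∀ v {b} → hook⁺ v ≤ b → length v ≤ suc b
fits⇒length≤ v fits = ≤-trans (m≤n+m (length v) (largestPart v)) (m≤n⇒m≤1+n fits)

module _ {a b : ℕ} (v : List ℕ) (fits : hook⁺ v ≤ b) (b<a : b < a) where

  private
    X = suc b ∸ length v
    R = a ∸ suc b

    arm+ℓ : X + length v ≡ suc b
    arm+ℓ = m∸n+n≡m (fits⇒length≤ v fits)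

    leg+b : R + suc b ≡ a
    leg+b = m∸n+n≡m b<a

  sum-wrapHook : sum (wrapHook a b v) ≡ a + sum v
  sum-wrapHook = begin
    X + sum (addColumn R v)       ≡⟨ cong (X +_) (sum-addColumn R v) ⟩
    X + (length v + sum v + R)    ≡⟨ shuffle X (length v) (sum v) R ⟩
    R + (X + length v) + sum v    ≡⟨ cong (λ c → R + c + sum v) arm+ℓ ⟩
    R + suc b + sum v             ≡⟨ cong (_+ sum v) leg+b ⟩
    a + sum v                     ∎
    where
    open ≡-Reasoning
    shuffle : ∀ x l s r → x + (l + s + r) ≡ r + (x + l) + s
    shuffle = solve-∀

  hook⁺-wrapHook : hook⁺ (wrapHook a b v) ≡ suc a
  hook⁺-wrapHook = begin
    X + suc (length (addColumn R v)) ≡⟨ cong (λ ℓ → X + suc ℓ) (length-addColumn R v) ⟩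
    X + suc (length v + R)           ≡⟨ shuffle X (length v) R ⟩
    suc (R + (X + length v))         ≡⟨ cong (λ c → suc (R + c)) arm+ℓ ⟩
    suc (R + suc b)                  ≡⟨ cong suc leg+b ⟩
    suc a                            ∎
    where
    open ≡-Reasoning
    shuffle : ∀ x l r → x + suc (l + r) ≡ suc (r + (x + l))
    shuffle = solve-∀

  largestHook-wrapHook : largestHook (wrapHook a b v) ≡ a
  largestHook-wrapHook = suc-injective (trans (sym (+-suc _ _)) hook⁺-wrapHook)

-- A missing last b counts as 0.
wrapHooks : List ℕ → List ℕ
wrapHooks []          = []
wrapHooks (a ∷ [])    = wrapHook a 0 []
wrapHooks (a ∷ b ∷ ρ) = wrapHook a b (wrapHooks ρ)

distinct-tail : ∀ {x ρ} → IsDistinctPartition (x ∷ ρ) → IsDistinctPartition ρ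
distinct-tail (ρ↘ , ρ>0) = Linked.tail ρ↘ , All.tail ρ>0

largestPart-tail< : ∀ {x ρ} → IsDistinctPartition (x ∷ ρ) → largestPart ρ < x
largestPart-tail< {ρ = []}    (_ , x>0 ∷ _) = x>0
largestPart-tail< {ρ = _ ∷ _} (x>y ∷ _ , _) = x>y

part⁺≤suc-largestPart : ∀ ρ → part⁺ ρ ≤ suc (largestPart ρ)
part⁺≤suc-largestPart []      = z≤n
part⁺≤suc-largestPart (_ ∷ _) = ≤-refl

pred-part⁺ : ∀ ρ → pred (part⁺ ρ) ≡ largestPart ρ
pred-part⁺ []      = refl
pred-part⁺ (_ ∷ _) = refl

length≤pred-hook⁺ : ∀ {ν} → All (0 <_) ν → length ν ≤ pred (hook⁺ ν)
length≤pred-hook⁺ []               = z≤n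
length≤pred-hook⁺ {suc x ∷ xs} _   = m≤n+m (length (suc x ∷ xs)) x

hook⁺-wrapHooks : ∀ {ρ} → IsDistinctPartition ρ → hook⁺ (wrapHooks ρ) ≡ part⁺ ρ
wrapHooks-fits : ∀ {b ρ} → IsDistinctPartition (b ∷ ρ) → hook⁺ (wrapHooks ρ) ≤ b

hook⁺-wrapHooks {[]}        _               = refl
hook⁺-wrapHooks {a ∷ []}    (_ , a>0 ∷ [])  = hook⁺-wrapHook [] z≤n a>0
hook⁺-wrapHooks {a ∷ b ∷ ρ} D@(a>b ∷ _ , _) =
  hook⁺-wrapHook (wrapHooks ρ) (wrapHooks-fits (distinct-tail D)) a>b

wrapHooks-fits {b} {ρ} D = begin
  hook⁺ (wrapHooks ρ)  ≡⟨ hook⁺-wrapHooks (distinct-tail D) ⟩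
  part⁺ ρ              ≤⟨ part⁺≤suc-largestPart ρ ⟩
  suc (largestPart ρ)  ≤⟨ largestPart-tail< D ⟩
  b                    ∎
  where open ≤-Reasoning

wrapHooks-isPartition : ∀ {ρ} → IsDistinctPartition ρ → IsPartition (wrapHooks ρ)
wrapHooks-isPartition {[]}        _ = [] , []
wrapHooks-isPartition {a ∷ []}    _ = wrapHook-isPartition a ([] , []) z≤n
wrapHooks-isPartition {a ∷ b ∷ ρ} D =
  wrapHook-isPartition a (wrapHooks-isPartition (distinct-tail (distinct-tail D)))
                         (wrapHooks-fits (distinct-tail D))

oddIndexedSum : List ℕ → ℕ
oddIndexedSum []      = 0
oddIndexedSum (x ∷ ρ) = x + evenIndexedSum ρ

evenIndexedSum-∷ : ∀ x ρ → evenIndexedSum (x ∷ ρ) ≡ oddIndexedSum ρ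
evenIndexedSum-∷ x []      = refl
evenIndexedSum-∷ x (_ ∷ _) = refl

sum-wrapHooks : ∀ {ρ} → IsDistinctPartition ρ → sum (wrapHooks ρ) ≡ oddIndexedSum ρ
sum-wrapHooks {[]}        _               = refl
sum-wrapHooks {a ∷ []}    (_ , a>0 ∷ [])  = sum-wrapHook [] z≤n a>0
sum-wrapHooks {a ∷ b ∷ ρ} D@(a>b ∷ _ , _) = begin
  sum (wrapHook a b (wrapHooks ρ))  ≡⟨ sum-wrapHook (wrapHooks ρ) (wrapHooks-fits (distinct-tail D)) a>b ⟩
  a + sum (wrapHooks ρ)             ≡⟨ cong (a +_) (sum-wrapHooks (distinct-tail (distinct-tail D))) ⟩
  a + oddIndexedSum ρ               ≡⟨ cong (a +_) (evenIndexedSum-∷ b ρ) ⟨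
  a + evenIndexedSum (b ∷ ρ)        ∎
  where open ≡-Reasoning

length-wrapHooks< : ∀ {b ρ} → IsDistinctPartition (b ∷ ρ) → length (wrapHooks ρ) < b
length-wrapHooks< {b} {ρ} D = begin-strict
  length (wrapHooks ρ)        ≤⟨ length≤pred-hook⁺ (proj₂ (wrapHooks-isPartition (distinct-tail D))) ⟩
  pred (hook⁺ (wrapHooks ρ))  ≡⟨ cong pred (hook⁺-wrapHooks (distinct-tail D)) ⟩
  pred (part⁺ ρ)              ≡⟨ pred-part⁺ ρ ⟩
  largestPart ρ               <⟨ largestPart-tail< D ⟩
  b                           ∎
  where open ≤-Reasoning

-- Stops at the first part ≤ 1, so on a partition it deletes the first column.
dropFirstColumn : List ℕ → List ℕ
dropFirstColumn (suc (suc x) ∷ xs) = suc x ∷ dropFirstColumn xs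
dropFirstColumn _                  = []

partition-tail : ∀ {x xs} → IsPartition (x ∷ xs) → IsPartition xs
partition-tail (xs↘ , xs>0) = Linked.tail xs↘ , All.tail xs>0

length-dropFirstColumn≤ : ∀ xs → length (dropFirstColumn xs) ≤ length xs
length-dropFirstColumn≤ []                 = z≤n
length-dropFirstColumn≤ (zero ∷ xs)        = z≤n
length-dropFirstColumn≤ (suc zero ∷ xs)    = z≤n
length-dropFirstColumn≤ (suc (suc x) ∷ xs) = s≤s (length-dropFirstColumn≤ xs)

length-dropFirstColumn : ∀ {xs} → All (1 <_) xs → length (dropFirstColumn xs) ≡ length xs
length-dropFirstColumn {[]}               []          = refl
length-dropFirstColumn {zero ∷ xs}        (() ∷ _)
length-dropFirstColumn {suc zero ∷ xs}    (s≤s () ∷ _)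
length-dropFirstColumn {suc (suc x) ∷ xs} (_ ∷ xs>1)  = cong suc (length-dropFirstColumn xs>1)

largestPart-dropFirstColumn< : ∀ {x xs} → IsPartition (x ∷ xs) → largestPart (dropFirstColumn xs) < x
largestPart-dropFirstColumn< {xs = []}               (_ , x>0 ∷ _) = x>0
largestPart-dropFirstColumn< {xs = zero ∷ _}         (_ , x>0 ∷ _) = x>0
largestPart-dropFirstColumn< {xs = suc zero ∷ _}     (_ , x>0 ∷ _) = x>0
largestPart-dropFirstColumn< {xs = suc (suc _) ∷ _} (x≥y ∷ _ , _) = x≥y

dropFirstColumn-isPartition : ∀ {xs} → IsPartition xs → IsPartition (dropFirstColumn xs)
dropFirstColumn-isPartition {[]}               _ = [] , []
dropFirstColumn-isPartition {zero ∷ xs}        _ = [] , []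
dropFirstColumn-isPartition {suc zero ∷ xs}    _ = [] , []
dropFirstColumn-isPartition {suc (suc x) ∷ xs} P =
  linked-∷ (≤-pred (largestPart-dropFirstColumn< P)) (proj₁ IH) , s≤s z≤n ∷ proj₂ IH
  where IH = dropFirstColumn-isPartition (partition-tail P)

dropFirstColumn-addColumn : ∀ r {v} → All (0 <_) v → dropFirstColumn (addColumn r v) ≡ v
dropFirstColumn-addColumn zero    []                 = refl
dropFirstColumn-addColumn (suc r) []                 = refl
dropFirstColumn-addColumn r       {suc y ∷ v} (_ ∷ v>0) = cong (suc y ∷_) (dropFirstColumn-addColumn r v>0)

ones-after-one : ∀ {ys} → IsPartition (1 ∷ ys) → ys ≡ replicate (length ys) 1
ones-after-one {[]}               _                 = refl
ones-after-one {zero ∷ ys}        (_ , _ ∷ () ∷ _)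
ones-after-one {suc zero ∷ ys}    P                 = cong (1 ∷_) (ones-after-one (partition-tail P))
ones-after-one {suc (suc y) ∷ ys} (s≤s () ∷ _ , _)

addColumn-dropFirstColumn : ∀ {xs} → IsPartition xs →
  addColumn (length xs ∸ length (dropFirstColumn xs)) (dropFirstColumn xs) ≡ xs
addColumn-dropFirstColumn {[]}               _               = refl
addColumn-dropFirstColumn {zero ∷ xs}        (_ , () ∷ _)
addColumn-dropFirstColumn {suc zero ∷ xs}    P               = cong (1 ∷_) (sym (ones-after-one P))
addColumn-dropFirstColumn {suc (suc x) ∷ xs} P               =
  cong (suc (suc x) ∷_) (addColumn-dropFirstColumn (partition-tail P))

wrapHook-dropFirstColumn : ∀ {x xs} → IsPartition (x ∷ xs) →
  wrapHook (x + length xs) (pred (x + length (dropFirstColumn xs))) (dropFirstColumn xs) ≡ x ∷ xs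
wrapHook-dropFirstColumn {zero}  {xs} (_ , () ∷ _)
wrapHook-dropFirstColumn {suc x} {xs} P = cong₂ _∷_
  (m+n∸n≡m (suc x) ℓ)
  (trans (cong (λ r → addColumn r v) ([m+n]∸[m+o]≡n∸o (suc x) (length xs) ℓ))
         (addColumn-dropFirstColumn (partition-tail P)))
  where
  v = dropFirstColumn xs
  ℓ = length v

_∷⁺_ : ℕ → List ℕ → List ℕ
zero  ∷⁺ ρ = ρ
suc b ∷⁺ ρ = suc b ∷ ρ

-- The first argument is fuel; length ν is enough, as every step removes the first row.
peelHooks : ℕ → List ℕ → List ℕ
peelHooks _       []       = []
peelHooks zero    (_ ∷ _)  = []
peelHooks (suc f) (x ∷ xs) =
  x + length xs ∷ (pred (x + length (dropFirstColumn xs)) ∷⁺ peelHooks f (dropFirstColumn xs))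

∷⁺-distinct : ∀ {a b ρ} → IsDistinctPartition ρ → part⁺ ρ ≤ b → b < a →
  IsDistinctPartition (a ∷ (b ∷⁺ ρ))
∷⁺-distinct {b = zero}  {[]}    _           _     0<a = [-] , 0<a ∷ []
∷⁺-distinct {b = suc c} {[]}    _           _     b<a = b<a ∷ [-] , m<n⇒0<n b<a ∷ s≤s z≤n ∷ []
∷⁺-distinct {b = suc c} {_ ∷ _} (ρ↘ , ρ>0) b>y   b<a = b<a ∷ b>y ∷ ρ↘ , m<n⇒0<n b<a ∷ s≤s z≤n ∷ ρ>0

wrapHooks-∷⁺ : ∀ a {b ρ} → part⁺ ρ ≤ b → wrapHooks (a ∷ (b ∷⁺ ρ)) ≡ wrapHook a b (wrapHooks ρ)
wrapHooks-∷⁺ a {zero}  {[]} _ = refl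
wrapHooks-∷⁺ a {suc b}      _ = refl

peelHooks-wrapHook : ∀ f {a b} v → All (0 <_) v → hook⁺ v ≤ b → b < a →
  peelHooks (suc f) (wrapHook a b v) ≡ a ∷ (b ∷⁺ peelHooks f v)
peelHooks-wrapHook f {a} {b} v v>0 fits b<a rewrite dropFirstColumn-addColumn (a ∸ suc b) v>0 =
  cong₂ (λ h c → h ∷ (pred c ∷⁺ peelHooks f v))
        (largestHook-wrapHook v fits b<a) (m∸n+n≡m (fits⇒length≤ v fits))

peelHooks-wrapHooks : ∀ f {ρ} → IsDistinctPartition ρ → length (wrapHooks ρ) ≤ f →
  peelHooks f (wrapHooks ρ) ≡ ρ
peelHooks-wrapHooks f       {[]}            _               _ = refl
peelHooks-wrapHooks (suc f) {a ∷ []}        (_ , a>0 ∷ [])  _ = peelHooks-wrapHook f [] [] z≤n a>0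
peelHooks-wrapHooks (suc f) {a ∷ zero ∷ ρ}  (_ , _ ∷ () ∷ _) _
peelHooks-wrapHooks (suc f) {a ∷ suc c ∷ ρ} D@(a>b ∷ _ , _) (s≤s ℓ≤f) = begin
  peelHooks (suc f) (wrapHook a (suc c) v) ≡⟨ peelHooks-wrapHook f v v>0 fits a>b ⟩
  a ∷ suc c ∷ peelHooks f v               ≡⟨ cong (λ r → a ∷ suc c ∷ r) (peelHooks-wrapHooks f Dρ ℓv≤f) ⟩
  a ∷ suc c ∷ ρ                           ∎
  where
  open ≡-Reasoning
  v = wrapHooks ρ
  Dρ = distinct-tail (distinct-tail D)
  v>0 = proj₂ (wrapHooks-isPartition Dρ)
  fits = wrapHooks-fits (distinct-tail D)
  ℓv≤f : length v ≤ f
  ℓv≤f = ≤-trans (m≤m+n (length v) _)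
                 (≤-trans (≤-reflexive (sym (length-addColumn (a ∸ suc (suc c)) v))) ℓ≤f)

wrapHooks-peelHooks : ∀ f {ν} → length ν ≤ f → IsPartition ν →
  IsDistinctPartition (peelHooks f ν) × wrapHooks (peelHooks f ν) ≡ ν
wrapHooks-peelHooks f       {[]}          _         _             = ([] , []) , refl
wrapHooks-peelHooks (suc f) {zero ∷ xs}   _         (_ , () ∷ _)
wrapHooks-peelHooks (suc f) {suc x ∷ xs} (s≤s ℓ≤f) P             =
  ∷⁺-distinct Dr fits b<a , wrapped
  where
  v = dropFirstColumn xs
  a = suc x + length xs
  b = x + length v
  r = peelHooks f v
  IH = wrapHooks-peelHooks f (≤-trans (length-dropFirstColumn≤ xs) ℓ≤f)
                             (dropFirstColumn-isPartition (partition-tail P))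
  Dr = proj₁ IH
  F∘r = proj₂ IH
  fits : part⁺ r ≤ b
  fits = begin
    part⁺ r                   ≡⟨ hook⁺-wrapHooks Dr ⟨
    hook⁺ (wrapHooks r)       ≡⟨ cong hook⁺ F∘r ⟩
    largestPart v + length v  ≤⟨ +-monoˡ-≤ (length v) (≤-pred (largestPart-dropFirstColumn< P)) ⟩
    b                         ∎
    where open ≤-Reasoning
  b<a : b < a
  b<a = s≤s (+-monoʳ-≤ x (length-dropFirstColumn≤ xs))
  wrapped : wrapHooks (a ∷ (b ∷⁺ r)) ≡ suc x ∷ xs
  wrapped = begin
    wrapHooks (a ∷ (b ∷⁺ r))    ≡⟨ wrapHooks-∷⁺ a fits ⟩
    wrapHook a b (wrapHooks r)  ≡⟨ cong (wrapHook a b) F∘r ⟩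
    wrapHook a b v              ≡⟨ wrapHook-dropFirstColumn P ⟩
    suc x ∷ xs                  ∎
    where open ≡-Reasoning

distinct-∷ : ∀ {m l} → IsDistinctPartition l → largestPart l ≡ m → IsDistinctPartition (suc m ∷ l)
distinct-∷ {l = []}    _          _    = [-] , s≤s z≤n ∷ []
distinct-∷ {l = _ ∷ _} (l↘ , l>0) refl = ≤-refl ∷ l↘ , s≤s z≤n ∷ l>0

wrapHook-parts>1 : ∀ {b v} → All (0 <_) v → length v < b → All (1 <_) (wrapHook (suc b) b v)
wrapHook-parts>1 {b} {v} v>0 ℓ<b =
  m+n≤o⇒m≤o∸n 2 (s≤s ℓ<b) ∷
  subst (λ r → All (1 <_) (addColumn r v)) (sym (n∸n≡0 b)) (addColumn-zero->1 v>0)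

hookSide-wrapHooks : ∀ {n m l} → n ≥ 1 → IsDistinctPartition l → largestPart l ≡ m →
  n ≡ largestPart l + evenIndexedSum l →
  IsPartitionOf (suc n) (wrapHooks (suc m ∷ l)) × All (1 <_) (wrapHooks (suc m ∷ l)) ×
  largestHook (wrapHooks (suc m ∷ l)) ≡ suc m
hookSide-wrapHooks {l = []}    () _ _ refl
hookSide-wrapHooks {m = m} {l = m ∷ ρ} _ D refl n≡ =
  (wrapHooks-isPartition D′ , trans (sum-wrapHooks D′) (cong suc (sym n≡))) ,
  wrapHook-parts>1 (proj₂ (wrapHooks-isPartition (distinct-tail D))) (length-wrapHooks< D) ,
  largestHook-wrapHook (wrapHooks ρ) (wrapHooks-fits D) (n<1+n m)
  where
  D′ = distinct-∷ D refl

∷⁺-pos : ∀ {b ρ} → 0 < b → b ∷⁺ ρ ≡ b ∷ ρ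
∷⁺-pos {suc b} _ = refl

peelHooks-hookSide : ∀ {m μ} → All (1 <_) μ → largestHook μ ≡ suc m →
  ∃ λ r → peelHooks (length μ) μ ≡ suc m ∷ m ∷ r
-- With no part equal to 1, deleting the first column keeps every row, so the first b is a − 1.
peelHooks-hookSide {m} {x ∷ xs} (x>1 ∷ xs>1) hook≡ rewrite length-dropFirstColumn xs>1 | hook≡ =
  _ , cong (suc m ∷_) (∷⁺-pos m>0)
  where
  m>0 : 0 < m
  m>0 = ≤-pred (≤-trans x>1 (≤-trans (m≤m+n x (length xs)) (≤-reflexive hook≡)))

distinctSide-peelHooks : ∀ {n m ρ r} → IsDistinctPartition ρ → sum (wrapHooks ρ) ≡ suc n →
  ρ ≡ suc m ∷ m ∷ r →
  IsDistinctPartition (drop 1 ρ) × largestPart (drop 1 ρ) ≡ m ×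
  n ≡ largestPart (drop 1 ρ) + evenIndexedSum (drop 1 ρ)
distinctSide-peelHooks D sum≡ refl =
  distinct-tail D , refl , suc-injective (trans (sym sum≡) (sum-wrapHooks D))

×-irrelevant : ∀ {A B : Set} → Irrelevant A → Irrelevant B → Irrelevant (A × B)
×-irrelevant irrA irrB (a , b) (a′ , b′) = cong₂ _,_ (irrA a a′) (irrB b b′)

Σ-≡-proj₁ : ∀ {A : Set} {P : A → Set} → (∀ {x} → Irrelevant (P x)) →
  {s t : Σ A P} → proj₁ s ≡ proj₁ t → s ≡ t
Σ-≡-proj₁ irr {x , p} {.x , q} refl = cong (x ,_) (irr p q)

distinctSide-irrelevant : ∀ {n m l} →
  Irrelevant (IsDistinctPartition l × largestPart l ≡ m × n ≡ largestPart l + evenIndexedSum l)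
distinctSide-irrelevant =
  ×-irrelevant (×-irrelevant (Linked.irrelevant <-irrelevant) (All.irrelevant <-irrelevant))
               (×-irrelevant ≡-irrelevant ≡-irrelevant)

hookSide-irrelevant : ∀ {n m l} →
  Irrelevant (IsPartitionOf (suc n) l × All (1 <_) l × largestHook l ≡ suc m)
hookSide-irrelevant =
  ×-irrelevant (×-irrelevant (×-irrelevant (Linked.irrelevant ≤-irrelevant) (All.irrelevant <-irrelevant))
                             ≡-irrelevant)
               (×-irrelevant (All.irrelevant <-irrelevant) ≡-irrelevant)

toHookSide : ∀ {n m} → n ≥ 1 → DistinctSide n m → HookSide n m
toHookSide {m = m} n≥1 (l , D , l₁≡m , n≡) = wrapHooks (suc m ∷ l) , hookSide-wrapHooks n≥1 D l₁≡m n≡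

toDistinctSide : ∀ {n m} → HookSide n m → DistinctSide n m
toDistinctSide (μ , (P , sum≡) , μ>1 , hook≡) = drop 1 (peelHooks (length μ) μ) ,
  distinctSide-peelHooks (proj₁ peeled) (trans (cong sum (proj₂ peeled)) sum≡)
                         (proj₂ (peelHooks-hookSide μ>1 hook≡))
  where peeled = wrapHooks-peelHooks (length μ) ≤-refl P

∷-drop-1 : ∀ {x : ℕ} {xs ρ : List ℕ} → ρ ≡ x ∷ xs → x ∷ drop 1 ρ ≡ ρ
∷-drop-1 refl = refl

toHookSide∘toDistinctSide : ∀ {n m} (n≥1 : n ≥ 1) (μ : HookSide n m) →
  toHookSide n≥1 (toDistinctSide μ) ≡ μ
toHookSide∘toDistinctSide {m = m} _ (μ , (P , _) , μ>1 , hook≡) = Σ-≡-proj₁ hookSide-irrelevant (begin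
  wrapHooks (suc m ∷ drop 1 ρ)  ≡⟨ cong wrapHooks (∷-drop-1 (proj₂ (peelHooks-hookSide μ>1 hook≡))) ⟩
  wrapHooks ρ                   ≡⟨ proj₂ (wrapHooks-peelHooks (length μ) ≤-refl P) ⟩
  μ                             ∎)
  where
  open ≡-Reasoning
  ρ = peelHooks (length μ) μ

toDistinctSide∘toHookSide : ∀ {n m} (n≥1 : n ≥ 1) (l : DistinctSide n m) →
  toDistinctSide (toHookSide n≥1 l) ≡ l
toDistinctSide∘toHookSide _ (l , D , l₁≡m , _) =
  Σ-≡-proj₁ distinctSide-irrelevant (cong (drop 1) (peelHooks-wrapHooks _ (distinct-∷ D l₁≡m) ≤-refl))

corollary1p7 : (n m : ℕ) → n ≥ 1 → DistinctSide n m ↔ HookSide n m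
corollary1p7 n m n≥1 =
  mk↔ₛ′ (toHookSide n≥1) toDistinctSide (toHookSide∘toDistinctSide n≥1) (toDistinctSide∘toHookSide n≥1)
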